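{- Let $V$ and $W$ be finite sets, $G\leq \mathrm{Sym}(V)$ and $H\leq \mathrm{Sym}(W)$, and let $G\times H$ act on $V\times W$ by $(g,h)\colon (v,w)\mapsto (g(v),h(w))$. If $H$ is regular, then $\overline{\Gamma_{G\times H}}$ is isomorphic to the disjoint union of $|H|$ copies of $\overline{\Gamma_G}$.
   Context: For a permutation group $K$ on a finite set, an element is a derangement if it fixes no point. The derangement graph $\Gamma_K$ is the graph with vertex set $K$ in which distinct $g,h$ are adjacent iff $gh^{ -1}$ is a derangement. $\overline{X}$ denotes the usual complement of a simple graph $X$ (no loops). -}

module Defs where

open import Data.Nat using (ℕ; _<_)
open import Data.Fin using (Fin)
open import Data.Fin.Properties using (any?)
open import Data.Vec using (Vec; lookup; tabulate; allFin)
open import Data.Bool using (Bool; T)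
open import Data.Product using (Σ; ∃; _×_; _,_; proj₁)
open import Relation.Nullary using (¬_; Dec; yes; no)
open import Relation.Binary.PropositionalEquality using (_≡_; _≢_)
open import Function.Bundles using (_↔_; _⇔_; Inverse)
import Data.Fin as F

-- Maps Fin n → Fin n, represented by their value tables (so that
-- equality of group elements is ordinary, decidable ≡).

Tab : ℕ → Set
Tab n = Vec (Fin n) n

app : ∀ {n} → Tab n → Fin n → Fin n
app = lookup

idT : ∀ {n} → Tab n
idT = allFin _

_∘T_ : ∀ {n} → Tab n → Tab n → Tab n
σ ∘T τ = tabulate (λ x → app σ (app τ x))

-- inverse table: x ↦ the (first) y with σ(y) = x  (the genuine inverse
-- when σ is a permutation)
pickPre : ∀ {n} (σ : Tab n) (x : Fin n) → Dec (∃ λ y → app σ y ≡ x) → Fin n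
pickPre σ x (yes (y , _)) = y
pickPre σ x (no _)        = x

invT : ∀ {n} → Tab n → Tab n
invT σ = tabulate (λ x → pickPre σ x (any? (λ y → app σ y F.≟ x)))

record PermGroup (n : ℕ) : Set where
  field
    mem     : Tab n → Bool
    perm    : ∀ σ → T (mem σ) → ∀ i j → app σ i ≡ app σ j → i ≡ j
    id-mem  : T (mem idT)
    ∘-mem   : ∀ σ τ → T (mem σ) → T (mem τ) → T (mem (σ ∘T τ))
    inv-mem : ∀ σ → T (mem σ) → T (mem (invT σ))

open PermGroup public

Elem : ∀ {n} → PermGroup n → Set
Elem G = Σ (Tab _) (λ σ → T (mem G σ))

Regular : ∀ {m} → PermGroup m → Set
Regular {m} H =
  (0 < m) ×
  (∀ (w w' : Fin m) →
     Σ (Elem H) (λ h → app (proj₁ h) w ≡ w' ×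
       (∀ (h' : Elem H) → app (proj₁ h') w ≡ w' → h' ≡ h)))

record Graph : Set₁ where
  field
    Vertex : Set
    Adj    : Vertex → Vertex → Set

open Graph public

complement : Graph → Graph
complement X = record
  { Vertex = Vertex X
  ; Adj    = λ x y → x ≢ y × ¬ Adj X x y }

copies : Set → Graph → Graph
copies I X = record
  { Vertex = I × Vertex X
  ; Adj    = λ { (i , x) (j , y) → i ≡ j × Adj X x y } }

record _≅_ (X Y : Graph) : Set where
  field
    bij : Vertex X ↔ Vertex Y
    adj : ∀ x y → Adj X x y ⇔ Adj Y (Inverse.to bij x) (Inverse.to bij y)

FixesNoPoint : {X : Set} → (X → X) → Set
FixesNoPoint {X} f = ∀ (x : X) → f x ≢ x

derangementGraph : ∀ {n} → PermGroup n → Graph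
derangementGraph G = record
  { Vertex = Elem G
  ; Adj    = λ g h → g ≢ h ×
      FixesNoPoint (app (proj₁ g ∘T invT (proj₁ h))) }

productAct : ∀ {n m} → Tab n → Tab m → Fin n × Fin m → Fin n × Fin m
productAct σ τ (v , w) = (app σ v , app τ w)

productDerangementGraph : ∀ {n m} → PermGroup n → PermGroup m → Graph
productDerangementGraph G H = record
  { Vertex = Elem G × Elem H
  ; Adj    = λ { (g , h) (g' , h') → (g , h) ≢ (g' , h') ×
      FixesNoPoint (productAct (proj₁ g ∘T invT (proj₁ g'))
                               (proj₁ h ∘T invT (proj₁ h'))) } }

-- The quotient (g g'⁻¹ , h h'⁻¹) fixes a point of V × W exactly when both coordinates
-- fix a point. For regular H, h h'⁻¹ fixes a point only if h = h' (a point stabiliser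
-- in H is trivial), so non-adjacency in Γ_{G×H} forces equal H-coordinates and then
-- reduces to non-adjacency of the G-coordinates in Γ_G. The complement of Γ_{G×H}
-- therefore falls apart into the fibres over H, each a copy of the complement of Γ_G.
module Submission where

open import Defs
open import Data.Nat using (ℕ; suc)
open import Data.Nat.Properties using (1+n≰n)
open import Data.Fin using (Fin; punchOut; fromℕ<; _≟_)
open import Data.Fin.Properties using (any?; punchOut-injective; injective⇒≤)
open import Data.Vec.Properties using (lookup∘tabulate; ≡-dec)
open import Data.Bool.Properties using (T-irrelevant)
open import Data.Product using (∃; _×_; _,_; proj₁; proj₂)
open import Data.Product.Function.NonDependent.Propositional using (_×-↔_; _×-⇔_)
open import Data.Empty using (⊥-elim)
open import Function.Bundles using (_↔_; _⇔_; Inverse; Injection; mk⇔)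
open import Function.Definitions using (Injective)
import Function.Properties.Equivalence as ⇔
open import Function.Properties.Inverse using (↔-refl; ↔-trans; ↔⇒↣)
open import Function.Related.TypeIsomorphisms using (×-comm)
open import Relation.Binary.Definitions using (DecidableEquality)
open import Relation.Nullary using (¬_; yes; no)
open import Relation.Binary.PropositionalEquality

-- Pigeonhole: if x had no preimage, punching x out of f would inject Fin (suc n) into Fin n.
injective⇒surjective : ∀ {n} (f : Fin n → Fin n) → Injective _≡_ _≡_ f →
                        ∀ x → ∃ λ y → f y ≡ x
injective⇒surjective {suc n} f f-inj x with any? (λ y → f y ≟ x)
... | yes preimage = preimage
... | no ¬preimage = ⊥-elim (1+n≰n (injective⇒≤ avoidingX-injective))
  where
  x≢f : ∀ y → x ≢ f y
  x≢f y eq = ¬preimage (y , sym eq)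

  avoidingX : Fin (suc n) → Fin n
  avoidingX y = punchOut (x≢f y)

  avoidingX-injective : Injective _≡_ _≡_ avoidingX
  avoidingX-injective eq = f-inj (punchOut-injective (x≢f _) (x≢f _) eq)

app-∘T : ∀ {n} (σ τ : Tab n) x → app (σ ∘T τ) x ≡ app σ (app τ x)
app-∘T σ τ x = lookup∘tabulate (λ y → app σ (app τ y)) x

invT-inverseʳ : ∀ {n} (σ : Tab n) → Injective _≡_ _≡_ (app σ) →
                ∀ x → app σ (app (invT σ) x) ≡ x
invT-inverseʳ σ σ-inj x
  rewrite lookup∘tabulate (λ y → pickPre σ y (any? (λ z → app σ z ≟ y))) x
  with any? (λ z → app σ z ≟ x)
... | yes (_ , σy≡x) = σy≡x
... | no ¬preimage   = ⊥-elim (¬preimage (injective⇒surjective (app σ) σ-inj x))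

∘T-invT-fixes : ∀ {n} (σ : Tab n) → Injective _≡_ _≡_ (app σ) →
                ∀ x → app (σ ∘T invT σ) x ≡ x
∘T-invT-fixes σ σ-inj x = trans (app-∘T σ (invT σ) x) (invT-inverseʳ σ σ-inj x)

module _ {n} (G : PermGroup n) where

  Elem-injective : (g : Elem G) → Injective _≡_ _≡_ (app (proj₁ g))
  Elem-injective (σ , σ∈G) = perm G σ σ∈G _ _

  Elem-≡ : ∀ {g g' : Elem G} → proj₁ g ≡ proj₁ g' → g ≡ g'
  Elem-≡ {σ , p} {.σ , q} refl = cong (σ ,_) (T-irrelevant p q)

  _≟Elem_ : DecidableEquality (Elem G)
  g ≟Elem g' with ≡-dec _≟_ (proj₁ g) (proj₁ g')
  ... | yes σ≡σ' = yes (Elem-≡ σ≡σ')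
  ... | no σ≢σ'  = no (λ g≡g' → σ≢σ' (cong proj₁ g≡g'))

module _ {m} (H : PermGroup m) where

  regular⇒point : Regular H → Fin m
  regular⇒point (0<m , _) = fromℕ< 0<m

  -- If h h'⁻¹ fixed w, then h and h' would both map u = h'⁻¹ w to w.
  regular⇒quotient-derangement : Regular H → ∀ (h h' : Elem H) → h ≢ h' →
                                 FixesNoPoint (app (proj₁ h ∘T invT (proj₁ h')))
  regular⇒quotient-derangement (_ , regular) h h' h≢h' w fixed =
    h≢h' (trans (unique h hu≡w) (sym (unique h' h'u≡w)))
    where
    u : Fin m
    u = app (invT (proj₁ h')) w

    unique : ∀ (k : Elem H) → app (proj₁ k) u ≡ w → k ≡ proj₁ (regular u w)
    unique = proj₂ (proj₂ (regular u w))

    hu≡w : app (proj₁ h) u ≡ w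
    hu≡w = trans (sym (app-∘T (proj₁ h) (invT (proj₁ h')) w)) fixed

    h'u≡w : app (proj₁ h') u ≡ w
    h'u≡w = invT-inverseʳ (proj₁ h') (Elem-injective H h') w

module _ {n m} (σ : Tab n) (τ : Tab m) where

  productAct-fixesNoPointˡ : FixesNoPoint (app σ) → FixesNoPoint (productAct σ τ)
  productAct-fixesNoPointˡ σ-free (v , _) fixed = σ-free v (cong proj₁ fixed)

  productAct-fixesNoPointʳ : FixesNoPoint (app τ) → FixesNoPoint (productAct σ τ)
  productAct-fixesNoPointʳ τ-free (_ , w) fixed = τ-free w (cong proj₂ fixed)

  productAct-fixesNoPoint⇒ˡ : ∀ w → app τ w ≡ w →
                              FixesNoPoint (productAct σ τ) → FixesNoPoint (app σ)
  productAct-fixesNoPoint⇒ˡ w τw≡w free v σv≡v = free (v , w) (cong₂ _,_ σv≡v τw≡w)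

complement-productDerangementGraph-adj :
  ∀ {n m} (G : PermGroup n) (H : PermGroup m) → Regular H →
  ∀ g g' h h' →
  Adj (complement (productDerangementGraph G H)) (g , h) (g' , h') ⇔
  (h ≡ h' × Adj (complement (derangementGraph G)) g g')
complement-productDerangementGraph-adj {n} {m} G H regular g g' h h' = mk⇔ to from
  where
  g÷g' : Tab n
  g÷g' = proj₁ g ∘T invT (proj₁ g')
  h÷h' : Tab m
  h÷h' = proj₁ h ∘T invT (proj₁ h')

  to : Adj (complement (productDerangementGraph G H)) (g , h) (g' , h') →
       h ≡ h' × Adj (complement (derangementGraph G)) g g'
  to (gh≢g'h' , ¬adjacent) = h≡h' , g≢g' , ¬g-adjacent
    where
    ¬g-adjacent : ¬ Adj (derangementGraph G) g g'
    ¬g-adjacent (_ , g-free) = ¬adjacent (gh≢g'h' , productAct-fixesNoPointˡ g÷g' h÷h' g-free)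

    h≡h' : h ≡ h'
    h≡h' with _≟Elem_ H h h'
    ... | yes h≡h' = h≡h'
    ... | no h≢h'  = ⊥-elim (¬adjacent (gh≢g'h' , productAct-fixesNoPointʳ g÷g' h÷h'
                      (regular⇒quotient-derangement H regular h h' h≢h')))

    g≢g' : g ≢ g'
    g≢g' g≡g' = gh≢g'h' (cong₂ _,_ g≡g' h≡h')

  from : h ≡ h' × Adj (complement (derangementGraph G)) g g' →
         Adj (complement (productDerangementGraph G H)) (g , h) (g' , h')
  from (refl , g≢g' , ¬g-adjacent) = gh≢g'h , ¬adjacent
    where
    gh≢g'h : (g , h) ≢ (g' , h)
    gh≢g'h eq = g≢g' (cong proj₁ eq)

    w : Fin m
    w = regular⇒point H regular

    ¬adjacent : ¬ Adj (productDerangementGraph G H) (g , h) (g' , h)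
    ¬adjacent (_ , free) = ¬g-adjacent (g≢g' , productAct-fixesNoPoint⇒ˡ g÷g' h÷h' w
      (∘T-invT-fixes (proj₁ h) (Elem-injective H h) w) free)

corollary3p2 : ∀ {n m : ℕ} (G : PermGroup n) (H : PermGroup m) →
    Regular H → (k : ℕ) → (Elem H ↔ Fin k) →
    complement (productDerangementGraph G H) ≅ copies (Fin k) (complement (derangementGraph G))
corollary3p2 G H regular k e = record { bij = bij ; adj = adj }
  where
  open Inverse e using (to)

  bij : (Elem G × Elem H) ↔ (Fin k × Elem G)
  bij = ↔-trans (×-comm _ _) (e ×-↔ ↔-refl)

  adj : ∀ x y → Adj (complement (productDerangementGraph G H)) x y ⇔
                Adj (copies (Fin k) (complement (derangementGraph G)))
                    (Inverse.to bij x) (Inverse.to bij y)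
  adj (g , h) (g' , h') =
    ⇔.trans (complement-productDerangementGraph-adj G H regular g g' h h')
            (mk⇔ (cong to) (Injection.injective (↔⇒↣ e)) ×-⇔ ⇔.refl)
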